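{- In the bang calculus: (1) $\to_{\mathsf{wv}}$ is quasi-strongly confluent, i.e. whenever $S_1 \leftarrow_{\mathsf{wv}} T \to_{\mathsf{wv}} S_2$, either $S_1 = S_2$ or there is $R$ with $S_1 \to_{\mathsf{wv}} R \leftarrow_{\mathsf{wv}} S_2$. (2) $\to_{\mathsf{wd}}$ and $\to_{\mathsf{d}}$ are each quasi-strongly confluent. (3) $\to_{\mathsf{wd}}$ and $\to_{\mathsf{wv}}$ strongly commute: if $S_1 \leftarrow_{\mathsf{wd}} T \to_{\mathsf{wv}} S_2$ then there is $R$ with $S_1 \to_{\mathsf{wv}} R \leftarrow_{\mathsf{wd}} S_2$. Moreover, if $S_1 \leftarrow_{\mathsf{d}} T \to_{\mathsf{v}} S_2$ then there is $R$ with $S_1 \to_{\mathsf{v}} R$ and $S_2 \to_{\mathsf{d}}^* R$. Moreover $\to_{\mathsf{d}}$ and $\to_{\mathsf{v}}$ commute: if $T \to_{\mathsf{d}}^* S_1$ and $T \to_{\mathsf{v}}^* S_2$ then there is $R$ with $S_1 \to_{\mathsf{v}}^* R$ and $S_2 \to_{\mathsf{d}}^* R$. (4) $\to_{\mathsf{v}}$ is confluent: if $T \to_{\mathsf{v}}^* S_1$ and $T\to_{\mathsf{v}}^* S_2$ then there is $R$ with $S_1 \to_{\mathsf{v}}^* R$ and $S_2 \to_{\mathsf{v}}^* R$.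
   Context: Terms of the bang calculus: $T,S,R ::= x \mid \lambda x\,T \mid T\,S \mid \mathrm{der}\,T \mid {!T}$ (variables from a countably infinite set, $\lambda$ the only binder, terms up to $\alpha$-conversion; $T\{S/x\}$ is capture-avoiding substitution). Contexts: $C ::= [\cdot] \mid \lambda x\,C \mid C\,T \mid T\,C \mid \mathrm{der}\,C \mid {!C}$. Ground contexts: $W ::= [\cdot] \mid \lambda x\,W \mid W\,T \mid T\,W \mid \mathrm{der}\,W$ (no hole under ${!}$). $C[T]$ denotes plugging $T$ into the hole (capture-allowing). Root steps: $(\lambda x\,T)\,({!S}) \mapsto_{\mathsf{v}} T\{S/x\}$ and $\mathrm{der}\,({!T}) \mapsto_{\mathsf{d}} T$. For $\mathsf{r}\in\{\mathsf{v},\mathsf{d}\}$, $T \to_{\mathsf{r}} S$ iff $T = C[T']$, $S = C[S']$ for some context $C$ and $T' \mapsto_{\mathsf{r}} S'$; $T \to_{\mathsf{wr}} S$ is defined in the same way but with ground contexts $W$ instead of $C$. $\to^*$ denotes reflexive-transitive closure. -}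

module Defs where

open import Data.Nat using (ℕ; zero; suc)
open import Data.Product using (Σ; ∃; ∃-syntax; _×_; _,_)
open import Relation.Binary.PropositionalEquality using (_≡_)

-- Terms of the bang calculus, up to α-conversion, via de Bruijn indices.
-- var n : variable; lam T : λ-abstraction (binds index 0 in T);
-- app T S : application; der T : dereliction; bang T : !T.
data Term : Set where
  var  : ℕ → Term
  lam  : Term → Term
  app  : Term → Term → Term
  der  : Term → Term
  bang : Term → Term

ext : (ℕ → ℕ) → ℕ → ℕ
ext ρ zero    = zero
ext ρ (suc n) = suc (ρ n)

rename : (ℕ → ℕ) → Term → Term
rename ρ (var n)   = var (ρ n)
rename ρ (lam T)   = lam (rename (ext ρ) T)
rename ρ (app T S) = app (rename ρ T) (rename ρ S)
rename ρ (der T)   = der (rename ρ T)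
rename ρ (bang T)  = bang (rename ρ T)

exts : (ℕ → Term) → ℕ → Term
exts σ zero    = var zero
exts σ (suc n) = rename suc (σ n)

subst : (ℕ → Term) → Term → Term
subst σ (var n)   = σ n
subst σ (lam T)   = lam (subst (exts σ) T)
subst σ (app T S) = app (subst σ T) (subst σ S)
subst σ (der T)   = der (subst σ T)
subst σ (bang T)  = bang (subst σ T)

-- T{S/x} where x is the variable bound by the enclosing λ (index 0)
sub0 : Term → ℕ → Term
sub0 S zero    = S
sub0 S (suc n) = var n

_[_] : Term → Term → Term
T [ S ] = subst (sub0 S) T

data _↦v_ : Term → Term → Set where
  β! : ∀ T S → app (lam T) (bang S) ↦v (T [ S ])

data _↦d_ : Term → Term → Set where
  d! : ∀ T → der (bang T) ↦d T

data Ctx : Set where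
  hole : Ctx
  lamC : Ctx → Ctx
  appL : Ctx → Term → Ctx
  appR : Term → Ctx → Ctx
  derC : Ctx → Ctx
  bangC : Ctx → Ctx

-- Capture-allowing plugging (in de Bruijn form: plain syntactic plugging)
plug : Ctx → Term → Term
plug hole        T = T
plug (lamC C)    T = lam (plug C T)
plug (appL C S)  T = app (plug C T) S
plug (appR S C)  T = app S (plug C T)
plug (derC C)    T = der (plug C T)
plug (bangC C)   T = bang (plug C T)

data Ground : Ctx → Set where
  hole : Ground hole
  lamC : ∀ {C} → Ground C → Ground (lamC C)
  appL : ∀ {C S} → Ground C → Ground (appL C S)
  appR : ∀ {S C} → Ground C → Ground (appR S C)
  derC : ∀ {C} → Ground C → Ground (derC C)

Rel : Set₁
Rel = Term → Term → Set

CtxClos : Rel → Rel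
CtxClos r T S = ∃[ C ] ∃[ T' ] ∃[ S' ] (T ≡ plug C T' × S ≡ plug C S' × r T' S')

WCtxClos : Rel → Rel
WCtxClos r T S = ∃[ C ] (Ground C × ∃[ T' ] ∃[ S' ] (T ≡ plug C T' × S ≡ plug C S' × r T' S'))

_→v_ _→d_ _→wv_ _→wd_ : Rel
_→v_  = CtxClos _↦v_
_→d_  = CtxClos _↦d_
_→wv_ = WCtxClos _↦v_
_→wd_ = WCtxClos _↦d_

data Star (r : Rel) : Rel where
  ε   : ∀ {T} → Star r T T
  _◅_ : ∀ {T S R} → r T S → Star r S R → Star r T R

-- Every statement about single steps is a critical-pair analysis on an inductive
-- presentation of the context closures.  Ground contexts never reach under !, so
-- weak steps overlap only when one of them contracts the root redex; there the
-- other step is inside the redex and survives the contraction as a single step.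
-- In full reduction a d-step inside the argument !S of a β-redex is duplicated or
-- erased by the substitution, which is why it is closed by several d-steps; the
-- strip argument then yields commutation of →d* and →v*.  Confluence of →v follows
-- from Takahashi's triangle property for parallel reduction, which lies between
-- →v and →v*.

module Submission where

open import Defs
open import Data.Nat using (zero; suc)
open import Data.Product using (∃-syntax; _×_; _,_)
open import Data.Sum using (_⊎_; inj₁; inj₂)
open import Function using (_∘_)
open import Relation.Binary.Core using (_⇒_; _Preserves_⟶_)
open import Relation.Binary.PropositionalEquality
  using (_≡_; refl; cong; cong₂; module ≡-Reasoning)

-- Renaming and substitution

ext-∘ : ∀ {ρ ρ′ ρ″} → (∀ n → ρ (ρ′ n) ≡ ρ″ n) → ∀ n → ext ρ (ext ρ′ n) ≡ ext ρ″ n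
ext-∘ h zero    = refl
ext-∘ h (suc n) = cong suc (h n)

rename-∘ : ∀ {ρ ρ′ ρ″} → (∀ n → ρ (ρ′ n) ≡ ρ″ n) → ∀ T → rename ρ (rename ρ′ T) ≡ rename ρ″ T
rename-∘ h (var n)   = cong var (h n)
rename-∘ h (lam T)   = cong lam (rename-∘ (ext-∘ h) T)
rename-∘ h (app T S) = cong₂ app (rename-∘ h T) (rename-∘ h S)
rename-∘ h (der T)   = cong der (rename-∘ h T)
rename-∘ h (bang T)  = cong bang (rename-∘ h T)

exts-ext : ∀ {σ ρ τ} → (∀ n → σ (ρ n) ≡ τ n) → ∀ n → exts σ (ext ρ n) ≡ exts τ n
exts-ext h zero    = refl
exts-ext h (suc n) = cong (rename suc) (h n)

subst-rename : ∀ {σ ρ τ} → (∀ n → σ (ρ n) ≡ τ n) → ∀ T → subst σ (rename ρ T) ≡ subst τ T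
subst-rename h (var n)   = h n
subst-rename h (lam T)   = cong lam (subst-rename (exts-ext h) T)
subst-rename h (app T S) = cong₂ app (subst-rename h T) (subst-rename h S)
subst-rename h (der T)   = cong der (subst-rename h T)
subst-rename h (bang T)  = cong bang (subst-rename h T)

ext-exts : ∀ {ρ σ τ} → (∀ n → rename ρ (σ n) ≡ τ n) → ∀ n → rename (ext ρ) (exts σ n) ≡ exts τ n
ext-exts h zero = refl
ext-exts {ρ} {σ} {τ} h (suc n) = begin
  rename (ext ρ) (rename suc (σ n)) ≡⟨ rename-∘ (λ _ → refl) (σ n) ⟩
  rename (suc ∘ ρ) (σ n)            ≡⟨ rename-∘ (λ _ → refl) (σ n) ⟨
  rename suc (rename ρ (σ n))       ≡⟨ cong (rename suc) (h n) ⟩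
  rename suc (τ n)                  ∎
  where open ≡-Reasoning

rename-subst : ∀ {ρ σ τ} → (∀ n → rename ρ (σ n) ≡ τ n) → ∀ T → rename ρ (subst σ T) ≡ subst τ T
rename-subst h (var n)   = h n
rename-subst h (lam T)   = cong lam (rename-subst (ext-exts h) T)
rename-subst h (app T S) = cong₂ app (rename-subst h T) (rename-subst h S)
rename-subst h (der T)   = cong der (rename-subst h T)
rename-subst h (bang T)  = cong bang (rename-subst h T)

exts-∘ : ∀ {σ τ υ} → (∀ n → subst σ (τ n) ≡ υ n) → ∀ n → subst (exts σ) (exts τ n) ≡ exts υ n
exts-∘ h zero = refl
exts-∘ {σ} {τ} {υ} h (suc n) = begin
  subst (exts σ) (rename suc (τ n)) ≡⟨ subst-rename (λ _ → refl) (τ n) ⟩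
  subst (rename suc ∘ σ) (τ n)      ≡⟨ rename-subst (λ _ → refl) (τ n) ⟨
  rename suc (subst σ (τ n))        ≡⟨ cong (rename suc) (h n) ⟩
  rename suc (υ n)                  ∎
  where open ≡-Reasoning

subst-∘ : ∀ {σ τ υ} → (∀ n → subst σ (τ n) ≡ υ n) → ∀ T → subst σ (subst τ T) ≡ subst υ T
subst-∘ h (var n)   = h n
subst-∘ h (lam T)   = cong lam (subst-∘ (exts-∘ h) T)
subst-∘ h (app T S) = cong₂ app (subst-∘ h T) (subst-∘ h S)
subst-∘ h (der T)   = cong der (subst-∘ h T)
subst-∘ h (bang T)  = cong bang (subst-∘ h T)

exts-var : ∀ {σ} → (∀ n → σ n ≡ var n) → ∀ n → exts σ n ≡ var n
exts-var h zero    = refl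
exts-var h (suc n) = cong (rename suc) (h n)

subst-var : ∀ {σ} → (∀ n → σ n ≡ var n) → ∀ T → subst σ T ≡ T
subst-var h (var n)   = h n
subst-var h (lam T)   = cong lam (subst-var (exts-var h) T)
subst-var h (app T S) = cong₂ app (subst-var h T) (subst-var h S)
subst-var h (der T)   = cong der (subst-var h T)
subst-var h (bang T)  = cong bang (subst-var h T)

subst-[] : ∀ σ T S → subst σ (T [ S ]) ≡ subst (exts σ) T [ subst σ S ]
subst-[] σ T S = begin
  subst σ (T [ S ])                              ≡⟨ subst-∘ (λ _ → refl) T ⟩
  subst (subst σ ∘ sub0 S) T                     ≡⟨ subst-∘ sub0-exts T ⟨
  subst (sub0 (subst σ S)) (subst (exts σ) T)    ∎
  where
  open ≡-Reasoning
  sub0-exts : ∀ n → subst (sub0 (subst σ S)) (exts σ n) ≡ subst σ (sub0 S n)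
  sub0-exts zero    = refl
  sub0-exts (suc n) = begin
    subst (sub0 (subst σ S)) (rename suc (σ n)) ≡⟨ subst-rename (λ _ → refl) (σ n) ⟩
    subst var (σ n)                              ≡⟨ subst-var (λ _ → refl) (σ n) ⟩
    σ n                                          ∎

rename-[] : ∀ ρ T S → rename ρ (T [ S ]) ≡ rename (ext ρ) T [ rename ρ S ]
rename-[] ρ T S = begin
  rename ρ (T [ S ])                           ≡⟨ rename-subst (λ _ → refl) T ⟩
  subst (rename ρ ∘ sub0 S) T                  ≡⟨ subst-rename sub0-ext T ⟨
  subst (sub0 (rename ρ S)) (rename (ext ρ) T) ∎
  where
  open ≡-Reasoning
  sub0-ext : ∀ n → sub0 (rename ρ S) (ext ρ n) ≡ rename ρ (sub0 S n)
  sub0-ext zero    = refl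
  sub0-ext (suc n) = refl

-- Reduction in (ground) contexts

data Mode : Set where
  weak full : Mode

data Step (r : Rel) : Mode → Rel where
  root   : ∀ {m T S} → r T S → Step r m T S
  ξ-lam  : ∀ {m T S} → Step r m T S → Step r m (lam T) (lam S)
  ξ-appₗ : ∀ {m T T′ S} → Step r m T T′ → Step r m (app T S) (app T′ S)
  ξ-appᵣ : ∀ {m T S S′} → Step r m S S′ → Step r m (app T S) (app T S′)
  ξ-der  : ∀ {m T S} → Step r m T S → Step r m (der T) (der S)
  ξ-bang : ∀ {T S} → Step r full T S → Step r full (bang T) (bang S)

ctxClos⇒full : ∀ {r} → CtxClos r ⇒ Step r full
ctxClos⇒full {r} (C , T , S , refl , refl , t↦s) = plugged C
  where
  plugged : ∀ C → Step r full (plug C T) (plug C S)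
  plugged hole        = root t↦s
  plugged (lamC C)    = ξ-lam (plugged C)
  plugged (appL C _)  = ξ-appₗ (plugged C)
  plugged (appR _ C)  = ξ-appᵣ (plugged C)
  plugged (derC C)    = ξ-der (plugged C)
  plugged (bangC C)   = ξ-bang (plugged C)

wCtxClos⇒weak : ∀ {r} → WCtxClos r ⇒ Step r weak
wCtxClos⇒weak {r} (_ , ground , T , S , refl , refl , t↦s) = plugged ground
  where
  plugged : ∀ {C} → Ground C → Step r weak (plug C T) (plug C S)
  plugged hole       = root t↦s
  plugged (lamC g)   = ξ-lam (plugged g)
  plugged (appL g)   = ξ-appₗ (plugged g)
  plugged (appR g)   = ξ-appᵣ (plugged g)
  plugged (derC g)   = ξ-der (plugged g)

step⇒ctxClos : ∀ {r m} → Step r m ⇒ CtxClos r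
step⇒ctxClos (root t↦s) = hole , _ , _ , refl , refl , t↦s
step⇒ctxClos (ξ-lam s) with step⇒ctxClos s
... | C , _ , _ , refl , refl , t↦s = lamC C , _ , _ , refl , refl , t↦s
step⇒ctxClos (ξ-appₗ {S = S} s) with step⇒ctxClos s
... | C , _ , _ , refl , refl , t↦s = appL C S , _ , _ , refl , refl , t↦s
step⇒ctxClos (ξ-appᵣ {T = T} s) with step⇒ctxClos s
... | C , _ , _ , refl , refl , t↦s = appR T C , _ , _ , refl , refl , t↦s
step⇒ctxClos (ξ-der s) with step⇒ctxClos s
... | C , _ , _ , refl , refl , t↦s = derC C , _ , _ , refl , refl , t↦s
step⇒ctxClos (ξ-bang s) with step⇒ctxClos s
... | C , _ , _ , refl , refl , t↦s = bangC C , _ , _ , refl , refl , t↦s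

weak⇒wCtxClos : ∀ {r} → Step r weak ⇒ WCtxClos r
weak⇒wCtxClos (root t↦s) = hole , hole , _ , _ , refl , refl , t↦s
weak⇒wCtxClos (ξ-lam s) with weak⇒wCtxClos s
... | C , g , _ , _ , refl , refl , t↦s = lamC C , lamC g , _ , _ , refl , refl , t↦s
weak⇒wCtxClos (ξ-appₗ {S = S} s) with weak⇒wCtxClos s
... | C , g , _ , _ , refl , refl , t↦s = appL C S , appL g , _ , _ , refl , refl , t↦s
weak⇒wCtxClos (ξ-appᵣ {T = T} s) with weak⇒wCtxClos s
... | C , g , _ , _ , refl , refl , t↦s = appR T C , appR g , _ , _ , refl , refl , t↦s
weak⇒wCtxClos (ξ-der s) with weak⇒wCtxClos s
... | C , g , _ , _ , refl , refl , t↦s = derC C , derC g , _ , _ , refl , refl , t↦s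

Step-rename : ∀ {r m} → (∀ ρ → rename ρ Preserves r ⟶ r) → ∀ ρ → rename ρ Preserves Step r m ⟶ Step r m
Step-rename h ρ (root t↦s) = root (h ρ t↦s)
Step-rename h ρ (ξ-lam s)  = ξ-lam (Step-rename h (ext ρ) s)
Step-rename h ρ (ξ-appₗ s) = ξ-appₗ (Step-rename h ρ s)
Step-rename h ρ (ξ-appᵣ s) = ξ-appᵣ (Step-rename h ρ s)
Step-rename h ρ (ξ-der s)  = ξ-der (Step-rename h ρ s)
Step-rename h ρ (ξ-bang s) = ξ-bang (Step-rename h ρ s)

Step-subst : ∀ {r m} → (∀ σ → subst σ Preserves r ⟶ r) → ∀ σ → subst σ Preserves Step r m ⟶ Step r m
Step-subst h σ (root t↦s) = root (h σ t↦s)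
Step-subst h σ (ξ-lam s)  = ξ-lam (Step-subst h (exts σ) s)
Step-subst h σ (ξ-appₗ s) = ξ-appₗ (Step-subst h σ s)
Step-subst h σ (ξ-appᵣ s) = ξ-appᵣ (Step-subst h σ s)
Step-subst h σ (ξ-der s)  = ξ-der (Step-subst h σ s)
Step-subst h σ (ξ-bang s) = ξ-bang (Step-subst h σ s)

↦v-subst : ∀ σ → subst σ Preserves _↦v_ ⟶ _↦v_
↦v-subst σ (β! T S) rewrite subst-[] σ T S = β! _ _

↦d-rename : ∀ ρ → rename ρ Preserves _↦d_ ⟶ _↦d_
↦d-rename ρ (d! T) = d! _

↦d-subst : ∀ σ → subst σ Preserves _↦d_ ⟶ _↦d_
↦d-subst σ (d! T) = d! _

-- Abstract rewriting

record Join (R Q : Rel) (S₁ S₂ : Term) : Set where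
  constructor join
  field
    {meet} : Term
    left   : R S₁ meet
    right  : Q S₂ meet

QuasiJoin : Rel → Rel
QuasiJoin R S₁ S₂ = S₁ ≡ S₂ ⊎ Join R R S₁ S₂

QuasiDiamond : Rel → Set
QuasiDiamond R = ∀ {T S₁ S₂} → R T S₁ → R T S₂ → QuasiJoin R S₁ S₂

StronglyCommute : Rel → Rel → Set
StronglyCommute R Q = ∀ {T S₁ S₂} → R T S₁ → Q T S₂ → Join Q R S₁ S₂

Commute : Rel → Rel → Set
Commute R Q = StronglyCommute (Star R) (Star Q)

Confluent : Rel → Set
Confluent R = Commute R R

Join-map : ∀ {R Q f} → f Preserves R ⟶ R → f Preserves Q ⟶ Q → f Preserves Join R Q ⟶ Join R Q
Join-map g h (join r q) = join (g r) (h q)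

QuasiJoin-map : ∀ {R f} → f Preserves R ⟶ R → f Preserves QuasiJoin R ⟶ QuasiJoin R
QuasiJoin-map g (inj₁ refl) = inj₁ refl
QuasiJoin-map g (inj₂ j)    = inj₂ (Join-map g g j)

QuasiJoin-sym : ∀ {R S₁ S₂} → QuasiJoin R S₁ S₂ → QuasiJoin R S₂ S₁
QuasiJoin-sym (inj₁ refl)       = inj₁ refl
QuasiJoin-sym (inj₂ (join r q)) = inj₂ (join q r)

Join⇒∃ : ∀ {R R′ Q Q′ : Rel} {S₁ S₂} → R ⇒ R′ → Q ⇒ Q′ → Join R Q S₁ S₂ → ∃[ U ] (R′ S₁ U × Q′ S₂ U)
Join⇒∃ f g (join r q) = _ , f r , g q

QuasiJoin⇒∃ : ∀ {R R′ : Rel} {S₁ S₂} → R ⇒ R′ → QuasiJoin R S₁ S₂ → S₁ ≡ S₂ ⊎ ∃[ U ] (R′ S₁ U × R′ S₂ U)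
QuasiJoin⇒∃ f (inj₁ eq) = inj₁ eq
QuasiJoin⇒∃ f (inj₂ j)  = inj₂ (Join⇒∃ f f j)

infixr 5 _◅◅_
_◅◅_ : ∀ {R T S U} → Star R T S → Star R S U → Star R T U
ε       ◅◅ rs′ = rs′
(r ◅ rs) ◅◅ rs′ = r ◅ (rs ◅◅ rs′)

return : ∀ {R} → R ⇒ Star R
return r = r ◅ ε

Star-map : ∀ {R R′ f} → f Preserves R ⟶ R′ → f Preserves Star R ⟶ Star R′
Star-map g ε        = ε
Star-map g (r ◅ rs) = g r ◅ Star-map g rs

Star-mono : ∀ {R R′} → R ⇒ R′ → Star R ⇒ Star R′
Star-mono g ε        = ε
Star-mono g (r ◅ rs) = g r ◅ Star-mono g rs

Star-concat : ∀ {R} → Star (Star R) ⇒ Star R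
Star-concat ε          = ε
Star-concat (rs ◅ rss) = rs ◅◅ Star-concat rss

module _ {R Q : Rel} (local : ∀ {T S₁ S₂} → R T S₁ → Q T S₂ → Join Q (Star R) S₁ S₂) where

  commute-strip : ∀ {T S₁ S₂} → Star R T S₁ → Q T S₂ → Join Q (Star R) S₁ S₂
  commute-strip ε        q = join q ε
  commute-strip (r ◅ rs) q with local r q
  ... | join q′ rs′ with commute-strip rs q′
  ... | join q″ rs″ = join q″ (rs′ ◅◅ rs″)

  commute-star : Commute R Q
  commute-star rs ε        = join ε rs
  commute-star rs (q ◅ qs) with commute-strip rs q
  ... | join q′ rs′ with commute-star rs′ qs
  ... | join qs′ rs″ = join (q′ ◅ qs′) rs″

triangle⇒confluent : ∀ {R} (dev : Term → Term) → (∀ {T T′} → R T T′ → R T′ (dev T)) → Confluent R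
triangle⇒confluent dev triangle = commute-star (λ p q → join (triangle p) (return (triangle q)))

confluent-sandwich : ∀ {R Q} → R ⇒ Q → Q ⇒ Star R → Confluent Q → Confluent R
confluent-sandwich R⊆Q Q⊆R* conf rs₁ rs₂ with conf (Star-mono R⊆Q rs₁) (Star-mono R⊆Q rs₂)
... | join qs₁ qs₂ = join (Star-concat (Star-mono Q⊆R* qs₁)) (Star-concat (Star-mono Q⊆R* qs₂))

-- Critical pairs

Step-quasiDiamond : ∀ {r m} → (∀ {T S₁ S₂} → r T S₁ → Step r m T S₂ → QuasiJoin (Step r m) S₁ S₂) →
                    QuasiDiamond (Step r m)
Step-quasiDiamond root-case (root t↦s) s = root-case t↦s s
Step-quasiDiamond root-case s (root t↦s) = QuasiJoin-sym (root-case t↦s s)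
Step-quasiDiamond root-case (ξ-lam s₁)  (ξ-lam s₂)  = QuasiJoin-map ξ-lam (Step-quasiDiamond root-case s₁ s₂)
Step-quasiDiamond root-case (ξ-appₗ s₁) (ξ-appₗ s₂) = QuasiJoin-map ξ-appₗ (Step-quasiDiamond root-case s₁ s₂)
Step-quasiDiamond root-case (ξ-appₗ s₁) (ξ-appᵣ s₂) = inj₂ (join (ξ-appᵣ s₂) (ξ-appₗ s₁))
Step-quasiDiamond root-case (ξ-appᵣ s₁) (ξ-appₗ s₂) = inj₂ (join (ξ-appₗ s₂) (ξ-appᵣ s₁))
Step-quasiDiamond root-case (ξ-appᵣ s₁) (ξ-appᵣ s₂) = QuasiJoin-map ξ-appᵣ (Step-quasiDiamond root-case s₁ s₂)
Step-quasiDiamond root-case (ξ-der s₁)  (ξ-der s₂)  = QuasiJoin-map ξ-der (Step-quasiDiamond root-case s₁ s₂)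
Step-quasiDiamond root-case (ξ-bang s₁) (ξ-bang s₂) = QuasiJoin-map ξ-bang (Step-quasiDiamond root-case s₁ s₂)

weak-v-quasiDiamond : QuasiDiamond (Step _↦v_ weak)
weak-v-quasiDiamond = Step-quasiDiamond root-case
  where
  root-case : ∀ {T S₁ S₂} → T ↦v S₁ → Step _↦v_ weak T S₂ → QuasiJoin (Step _↦v_ weak) S₁ S₂
  root-case (β! T S) (root (β! .T .S))   = inj₁ refl
  root-case (β! T S) (ξ-appₗ (root ()))
  root-case (β! T S) (ξ-appₗ (ξ-lam s)) = inj₂ (join (Step-subst ↦v-subst (sub0 S) s) (root (β! _ _)))
  root-case (β! T S) (ξ-appᵣ (root ()))

weak-d-quasiDiamond : QuasiDiamond (Step _↦d_ weak)
weak-d-quasiDiamond = Step-quasiDiamond root-case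
  where
  root-case : ∀ {T S₁ S₂} → T ↦d S₁ → Step _↦d_ weak T S₂ → QuasiJoin (Step _↦d_ weak) S₁ S₂
  root-case (d! T) (root (d! .T))      = inj₁ refl
  root-case (d! T) (ξ-der (root ()))

full-d-quasiDiamond : QuasiDiamond (Step _↦d_ full)
full-d-quasiDiamond = Step-quasiDiamond root-case
  where
  root-case : ∀ {T S₁ S₂} → T ↦d S₁ → Step _↦d_ full T S₂ → QuasiJoin (Step _↦d_ full) S₁ S₂
  root-case (d! T) (root (d! .T))      = inj₁ refl
  root-case (d! T) (ξ-der (root ()))
  root-case (d! T) (ξ-der (ξ-bang s)) = inj₂ (join s (root (d! _)))

weak-d-v-stronglyCommute : StronglyCommute (Step _↦d_ weak) (Step _↦v_ weak)
weak-d-v-stronglyCommute (root (d! T)) (root ())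
weak-d-v-stronglyCommute (root (d! T)) (ξ-der (root ()))
weak-d-v-stronglyCommute (ξ-appₗ (root ())) (root (β! T S))
weak-d-v-stronglyCommute (ξ-appₗ (ξ-lam s)) (root (β! T S)) = join (root (β! _ _)) (Step-subst ↦d-subst (sub0 S) s)
weak-d-v-stronglyCommute (ξ-appᵣ (root ())) (root (β! T S))
weak-d-v-stronglyCommute (ξ-lam s₁)  (ξ-lam s₂)  = Join-map ξ-lam ξ-lam (weak-d-v-stronglyCommute s₁ s₂)
weak-d-v-stronglyCommute (ξ-appₗ s₁) (ξ-appₗ s₂) = Join-map ξ-appₗ ξ-appₗ (weak-d-v-stronglyCommute s₁ s₂)
weak-d-v-stronglyCommute (ξ-appₗ s₁) (ξ-appᵣ s₂) = join (ξ-appᵣ s₂) (ξ-appₗ s₁)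
weak-d-v-stronglyCommute (ξ-appᵣ s₁) (ξ-appₗ s₂) = join (ξ-appₗ s₂) (ξ-appᵣ s₁)
weak-d-v-stronglyCommute (ξ-appᵣ s₁) (ξ-appᵣ s₂) = Join-map ξ-appᵣ ξ-appᵣ (weak-d-v-stronglyCommute s₁ s₂)
weak-d-v-stronglyCommute (ξ-der s₁)  (ξ-der s₂)  = Join-map ξ-der ξ-der (weak-d-v-stronglyCommute s₁ s₂)

subst-Star-cong : ∀ {r} → (∀ ρ → rename ρ Preserves r ⟶ r) → ∀ {σ σ′} →
                  (∀ n → Star (Step r full) (σ n) (σ′ n)) → ∀ T → Star (Step r full) (subst σ T) (subst σ′ T)
subst-Star-cong h σ↠σ′ (var n)   = σ↠σ′ n
subst-Star-cong {r} h {σ} {σ′} σ↠σ′ (lam T) = Star-map ξ-lam (subst-Star-cong h exts↠ T)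
  where
  exts↠ : ∀ n → Star (Step r full) (exts σ n) (exts σ′ n)
  exts↠ zero    = ε
  exts↠ (suc n) = Star-map (Step-rename h suc) (σ↠σ′ n)
subst-Star-cong h σ↠σ′ (app T S) =
  Star-map ξ-appₗ (subst-Star-cong h σ↠σ′ T) ◅◅ Star-map ξ-appᵣ (subst-Star-cong h σ↠σ′ S)
subst-Star-cong h σ↠σ′ (der T)   = Star-map ξ-der (subst-Star-cong h σ↠σ′ T)
subst-Star-cong h σ↠σ′ (bang T)  = Star-map ξ-bang (subst-Star-cong h σ↠σ′ T)

full-d-v-commute-step : ∀ {T S₁ S₂} → Step _↦d_ full T S₁ → Step _↦v_ full T S₂ →
                        Join (Step _↦v_ full) (Star (Step _↦d_ full)) S₁ S₂
full-d-v-commute-step (root (d! T)) (root ())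
full-d-v-commute-step (root (d! T)) (ξ-der (root ()))
full-d-v-commute-step (root (d! T)) (ξ-der (ξ-bang s)) = join s (return (root (d! _)))
full-d-v-commute-step (ξ-appₗ (root ())) (root (β! T S))
full-d-v-commute-step (ξ-appₗ (ξ-lam s)) (root (β! T S)) =
  join (root (β! _ _)) (return (Step-subst ↦d-subst (sub0 S) s))
full-d-v-commute-step (ξ-appᵣ (root ())) (root (β! T S))
full-d-v-commute-step (ξ-appᵣ (ξ-bang {S = S′} s)) (root (β! T S)) =
  join (root (β! _ _)) (subst-Star-cong ↦d-rename sub0↠ T)
  where
  sub0↠ : ∀ n → Star (Step _↦d_ full) (sub0 S n) (sub0 S′ n)
  sub0↠ zero    = return s
  sub0↠ (suc n) = ε
full-d-v-commute-step (ξ-lam s₁)  (ξ-lam s₂)  = Join-map ξ-lam (Star-map ξ-lam) (full-d-v-commute-step s₁ s₂)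
full-d-v-commute-step (ξ-appₗ s₁) (ξ-appₗ s₂) = Join-map ξ-appₗ (Star-map ξ-appₗ) (full-d-v-commute-step s₁ s₂)
full-d-v-commute-step (ξ-appₗ s₁) (ξ-appᵣ s₂) = join (ξ-appᵣ s₂) (return (ξ-appₗ s₁))
full-d-v-commute-step (ξ-appᵣ s₁) (ξ-appₗ s₂) = join (ξ-appₗ s₂) (return (ξ-appᵣ s₁))
full-d-v-commute-step (ξ-appᵣ s₁) (ξ-appᵣ s₂) = Join-map ξ-appᵣ (Star-map ξ-appᵣ) (full-d-v-commute-step s₁ s₂)
full-d-v-commute-step (ξ-der s₁)  (ξ-der s₂)  = Join-map ξ-der (Star-map ξ-der) (full-d-v-commute-step s₁ s₂)
full-d-v-commute-step (ξ-bang s₁) (ξ-bang s₂) = Join-map ξ-bang (Star-map ξ-bang) (full-d-v-commute-step s₁ s₂)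

-- Parallel reduction

infix 4 _⇛_
data _⇛_ : Rel where
  ⇛-var  : ∀ {n} → var n ⇛ var n
  ⇛-lam  : ∀ {T T′} → T ⇛ T′ → lam T ⇛ lam T′
  ⇛-app  : ∀ {T T′ S S′} → T ⇛ T′ → S ⇛ S′ → app T S ⇛ app T′ S′
  ⇛-der  : ∀ {T T′} → T ⇛ T′ → der T ⇛ der T′
  ⇛-bang : ∀ {T T′} → T ⇛ T′ → bang T ⇛ bang T′
  ⇛-β    : ∀ {T T′ S S′} → T ⇛ T′ → S ⇛ S′ → app (lam T) (bang S) ⇛ T′ [ S′ ]

⇛-refl : ∀ T → T ⇛ T
⇛-refl (var n)   = ⇛-var
⇛-refl (lam T)   = ⇛-lam (⇛-refl T)
⇛-refl (app T S) = ⇛-app (⇛-refl T) (⇛-refl S)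
⇛-refl (der T)   = ⇛-der (⇛-refl T)
⇛-refl (bang T)  = ⇛-bang (⇛-refl T)

⇛-rename : ∀ ρ → rename ρ Preserves _⇛_ ⟶ _⇛_
⇛-rename ρ ⇛-var        = ⇛-var
⇛-rename ρ (⇛-lam p)    = ⇛-lam (⇛-rename (ext ρ) p)
⇛-rename ρ (⇛-app p q)  = ⇛-app (⇛-rename ρ p) (⇛-rename ρ q)
⇛-rename ρ (⇛-der p)    = ⇛-der (⇛-rename ρ p)
⇛-rename ρ (⇛-bang p)   = ⇛-bang (⇛-rename ρ p)
⇛-rename ρ (⇛-β {T′ = T′} {S′ = S′} p q) rewrite rename-[] ρ T′ S′ =
  ⇛-β (⇛-rename (ext ρ) p) (⇛-rename ρ q)

⇛-exts : ∀ {σ σ′} → (∀ n → σ n ⇛ σ′ n) → ∀ n → exts σ n ⇛ exts σ′ n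
⇛-exts σ⇛σ′ zero    = ⇛-var
⇛-exts σ⇛σ′ (suc n) = ⇛-rename suc (σ⇛σ′ n)

⇛-subst : ∀ {σ σ′ T T′} → (∀ n → σ n ⇛ σ′ n) → T ⇛ T′ → subst σ T ⇛ subst σ′ T′
⇛-subst σ⇛σ′ (⇛-var {n})  = σ⇛σ′ n
⇛-subst σ⇛σ′ (⇛-lam p)    = ⇛-lam (⇛-subst (⇛-exts σ⇛σ′) p)
⇛-subst σ⇛σ′ (⇛-app p q)  = ⇛-app (⇛-subst σ⇛σ′ p) (⇛-subst σ⇛σ′ q)
⇛-subst σ⇛σ′ (⇛-der p)    = ⇛-der (⇛-subst σ⇛σ′ p)
⇛-subst σ⇛σ′ (⇛-bang p)   = ⇛-bang (⇛-subst σ⇛σ′ p)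
⇛-subst {σ′ = σ′} σ⇛σ′ (⇛-β {T′ = T′} {S′ = S′} p q) rewrite subst-[] σ′ T′ S′ =
  ⇛-β (⇛-subst (⇛-exts σ⇛σ′) p) (⇛-subst σ⇛σ′ q)

⇛-[] : ∀ {T T′ S S′} → T ⇛ T′ → S ⇛ S′ → T [ S ] ⇛ T′ [ S′ ]
⇛-[] {S = S} {S′ = S′} p q = ⇛-subst sub0⇛ p
  where
  sub0⇛ : ∀ n → sub0 S n ⇛ sub0 S′ n
  sub0⇛ zero    = q
  sub0⇛ (suc n) = ⇛-var

develop : Term → Term
develop (var n)                = var n
develop (lam T)                = lam (develop T)
develop (app (lam T) (bang S)) = develop T [ develop S ]
develop (app T S)              = app (develop T) (develop S)
develop (der T)                = der (develop T)
develop (bang T)               = bang (develop T)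

data AppView : Term → Term → Set where
  redex : ∀ {T S} → AppView (lam T) (bang S)
  other : ∀ {T S} → develop (app T S) ≡ app (develop T) (develop S) → AppView T S

appView : ∀ T S → AppView T S
appView (lam T)   (bang S)  = redex
appView (var _)   _         = other refl
appView (app _ _) _         = other refl
appView (der _)   _         = other refl
appView (bang _)  _         = other refl
appView (lam _)   (var _)   = other refl
appView (lam _)   (lam _)   = other refl
appView (lam _)   (app _ _) = other refl
appView (lam _)   (der _)   = other refl

⇛-develop : ∀ {T T′} → T ⇛ T′ → T′ ⇛ develop T
⇛-develop ⇛-var       = ⇛-var
⇛-develop (⇛-lam p)   = ⇛-lam (⇛-develop p)
⇛-develop (⇛-app {T = T} {S = S} p q) with appView T S
⇛-develop (⇛-app (⇛-lam p) (⇛-bang q)) | redex = ⇛-β (⇛-develop p) (⇛-develop q)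
⇛-develop (⇛-app p q) | other eq rewrite eq = ⇛-app (⇛-develop p) (⇛-develop q)
⇛-develop (⇛-der p)   = ⇛-der (⇛-develop p)
⇛-develop (⇛-bang p)  = ⇛-bang (⇛-develop p)
⇛-develop (⇛-β p q)   = ⇛-[] (⇛-develop p) (⇛-develop q)

v⊆⇛ : Step _↦v_ full ⇒ _⇛_
v⊆⇛ (root (β! T S))      = ⇛-β (⇛-refl T) (⇛-refl S)
v⊆⇛ (ξ-lam s)            = ⇛-lam (v⊆⇛ s)
v⊆⇛ (ξ-appₗ {S = S} s)   = ⇛-app (v⊆⇛ s) (⇛-refl S)
v⊆⇛ (ξ-appᵣ {T = T} s)   = ⇛-app (⇛-refl T) (v⊆⇛ s)
v⊆⇛ (ξ-der s)            = ⇛-der (v⊆⇛ s)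
v⊆⇛ (ξ-bang s)           = ⇛-bang (v⊆⇛ s)

⇛⊆v* : _⇛_ ⇒ Star (Step _↦v_ full)
⇛⊆v* ⇛-var       = ε
⇛⊆v* (⇛-lam p)   = Star-map ξ-lam (⇛⊆v* p)
⇛⊆v* (⇛-app p q) = Star-map ξ-appₗ (⇛⊆v* p) ◅◅ Star-map ξ-appᵣ (⇛⊆v* q)
⇛⊆v* (⇛-der p)   = Star-map ξ-der (⇛⊆v* p)
⇛⊆v* (⇛-bang p)  = Star-map ξ-bang (⇛⊆v* p)
⇛⊆v* (⇛-β p q)   =
  Star-map (ξ-appₗ ∘ ξ-lam) (⇛⊆v* p) ◅◅ Star-map (ξ-appᵣ ∘ ξ-bang) (⇛⊆v* q) ◅◅ return (root (β! _ _))

full-v-confluent : Confluent (Step _↦v_ full)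
full-v-confluent = confluent-sandwich v⊆⇛ ⇛⊆v* (triangle⇒confluent develop ⇛-develop)

lemma3 :
    -- (1) →wv quasi-strongly confluent
    (∀ {T S₁ S₂} → T →wv S₁ → T →wv S₂ → S₁ ≡ S₂ ⊎ ∃[ R ] (S₁ →wv R × S₂ →wv R))
    -- (2) →wd and →d quasi-strongly confluent
    × (∀ {T S₁ S₂} → T →wd S₁ → T →wd S₂ → S₁ ≡ S₂ ⊎ ∃[ R ] (S₁ →wd R × S₂ →wd R))
    × (∀ {T S₁ S₂} → T →d S₁ → T →d S₂ → S₁ ≡ S₂ ⊎ ∃[ R ] (S₁ →d R × S₂ →d R))
    -- (3) strong commutation of →wd and →wv
    × (∀ {T S₁ S₂} → T →wd S₁ → T →wv S₂ → ∃[ R ] (S₁ →wv R × S₂ →wd R))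
    × (∀ {T S₁ S₂} → T →d S₁ → T →v S₂ → ∃[ R ] (S₁ →v R × Star _→d_ S₂ R))
    × (∀ {T S₁ S₂} → Star _→d_ T S₁ → Star _→v_ T S₂ → ∃[ R ] (Star _→v_ S₁ R × Star _→d_ S₂ R))
    -- (4) →v confluent
    × (∀ {T S₁ S₂} → Star _→v_ T S₁ → Star _→v_ T S₂ → ∃[ R ] (Star _→v_ S₁ R × Star _→v_ S₂ R))
lemma3 =
    (λ s₁ s₂ → QuasiJoin⇒∃ weak⇒wCtxClos (weak-v-quasiDiamond (wCtxClos⇒weak s₁) (wCtxClos⇒weak s₂)))
  , (λ s₁ s₂ → QuasiJoin⇒∃ weak⇒wCtxClos (weak-d-quasiDiamond (wCtxClos⇒weak s₁) (wCtxClos⇒weak s₂)))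
  , (λ s₁ s₂ → QuasiJoin⇒∃ step⇒ctxClos (full-d-quasiDiamond (ctxClos⇒full s₁) (ctxClos⇒full s₂)))
  , (λ s₁ s₂ → Join⇒∃ weak⇒wCtxClos weak⇒wCtxClos
                 (weak-d-v-stronglyCommute (wCtxClos⇒weak s₁) (wCtxClos⇒weak s₂)))
  , (λ s₁ s₂ → Join⇒∃ step⇒ctxClos (Star-mono step⇒ctxClos)
                 (full-d-v-commute-step (ctxClos⇒full s₁) (ctxClos⇒full s₂)))
  , (λ ss₁ ss₂ → Join⇒∃ (Star-mono step⇒ctxClos) (Star-mono step⇒ctxClos)
                   (commute-star full-d-v-commute-step (Star-mono ctxClos⇒full ss₁) (Star-mono ctxClos⇒full ss₂)))
  , (λ ss₁ ss₂ → Join⇒∃ (Star-mono step⇒ctxClos) (Star-mono step⇒ctxClos)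
                   (full-v-confluent (Star-mono ctxClos⇒full ss₁) (Star-mono ctxClos⇒full ss₂)))
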